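{- Fix an integer $c\ge 2$ and an action ${<}\in\mathbf{A}$. Let $T=(S,A,\ell)$ be a finite LTS over $\mathbf{A}$ and some $\mathbf{P}$ such that the relation $\{(s,t)\mid (s,<,t)\in A\}$ is a strict total order on $S$. Define types $\tau_1=\bullet^c$ (the compound type $\bullet,\dots,\bullet$ with $c$ components) and $\tau_{i+1}=(\tau_i)$. Define formulas $\varphi^1_<(X_1,\dots,X_c,Y_1,\dots,Y_c)=\bigvee_{i=1}^c\big(<(X_i,Y_i)\wedge\bigwedge_{j=1}^{i-1}\neg<(Y_j,X_j)\big)$ (all variables of type $\bullet$), $\varphi^2_<(X,Y{:}\tau_2)=\exists(Z_1,\dots,Z_c{:}\bullet).\,Y(Z_1,\dots,Z_c)\wedge\neg X(Z_1,\dots,Z_c)\wedge\forall(Z'_1,\dots,Z'_c{:}\bullet).\big(\varphi^1_<(Z'_1,\dots,Z'_c,Z_1,\dots,Z_c)\rightarrow(X(Z'_1,\dots,Z'_c)\rightarrow Y(Z'_1,\dots,Z'_c))\big)$, and for $i\ge 2$: $\varphi^{i+1}_<(X,Y{:}\tau_{i+1})=\exists(Z{:}\tau_i).\,Y(Z)\wedge\neg X(Z)\wedge\forall(Z'{:}\tau_i).\big(\varphi^i_<(Z',Z)\rightarrow(X(Z')\rightarrow Y(Z'))\big)$. Then for all $k\ge 1$: (i) $|[\![\tau_k]\!]_T|=\mathrm{twr}(|S|^c,k-1)$; (ii) the binary relation on $[\![\tau_k]\!]_T$ consisting of the pairs of elements satisfying $\varphi^k_<$ (under the assignment of the two argument variables,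 resp. argument tuples, to them) is a total order on $[\![\tau_k]\!]_T$.
   Context: $\mathrm{twr}(n,0)=n$, $\mathrm{twr}(n,k+1)=2^{\mathrm{twr}(n,k)}$. An LTS is $T=(S,A,\ell)$ with $S$ finite nonempty, $A\subseteq S\times\mathbf{A}\times S$, $\ell:S\to2^{\mathbf{P}}$. Type semantics: $[\![\bullet]\!]_T=S$, $[\![\tau_1,\dots,\tau_n]\!]_T=\prod_i[\![\tau_i]\!]_T$, $[\![(\tau)]\!]_T=2^{[\![\tau]\!]_T}$. Formula semantics (higher-order logic): $<(X,Y)$ holds iff $(\eta(X),<,\eta(Y))\in A$; $X(Y_1,\dots,Y_n)$ holds iff $(\eta(Y_1),\dots,\eta(Y_n))\in\eta(X)$; $\exists(X{:}\tau)$ ranges over $[\![\tau]\!]_T$; Boolean connectives, $\forall$, $\rightarrow$ as usual. -}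

module Defs where

open import Level using (0ℓ)
open import Data.Nat using (ℕ; zero; suc; _^_; NonZero)
open import Data.Fin using (Fin; _<_)
open import Data.Vec using (Vec; lookup)
open import Data.Bool using (Bool; true)
open import Data.Product using (Σ; Σ-syntax; _×_)
open import Relation.Nullary using (¬_)
open import Relation.Binary.Bundles using (Setoid)
open import Relation.Binary.PropositionalEquality using (_≡_)
import Relation.Binary.PropositionalEquality as ≡
open import Function.Bundles using (Func; _⟨$⟩_)
import Function.Relation.Binary.Setoid.Equality as FunEq

twr : ℕ → ℕ → ℕ
twr n zero    = n
twr n (suc k) = 2 ^ twr n k

-- S is represented as Fin size (so |S| = size),
-- nonempty; A ⊆ S × 𝐀 × S is given as a relation; ℓ : S → 2^𝐏.
record LTS (Act Prp : Set) : Set₁ where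
  field
    size     : ℕ
    nonEmpty : NonZero size
    trans    : Fin size → Act → Fin size → Set
    label    : Fin size → Prp → Bool

module _ {Act Prp : Set} (T : LTS Act Prp) (c : ℕ) where
  open LTS T

  -- Semantic domains of the types τ_{k+1}, as setoids:
  --   ⟦τ₁⟧ = ⟦•,…,•⟧ = S^c (c-tuples, propositional equality),
  --   ⟦τ_{k+2}⟧ = ⟦(τ_{k+1})⟧ = 2^⟦τ_{k+1}⟧, subsets given by (equality
  --   respecting) characteristic functions, with extensional equality.
  -- Dom k is the domain of τ_{k+1}.
  Dom : ℕ → Setoid 0ℓ 0ℓ
  Dom zero    = ≡.setoid (Vec (Fin size) c)
  Dom (suc k) = FunEq.setoid (Dom k) (≡.setoid Bool)

  Elem : ℕ → Set
  Elem k = Setoid.Carrier (Dom k)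

  _∋_ : {k : ℕ} → Elem (suc k) → Elem k → Set
  X ∋ Z = (X ⟨$⟩ Z) ≡ true

  φ : (lt : Act) → (k : ℕ) → Elem k → Elem k → Set
  φ lt zero    X Y = Σ[ i ∈ Fin c ]
    ( trans (lookup X i) lt (lookup Y i)
    × (∀ (j : Fin c) → j < i → ¬ trans (lookup Y j) lt (lookup X j)) )
  φ lt (suc k) X Y = Σ[ Z ∈ Elem k ]
    ( (_∋_ {k} Y Z) × ¬ (_∋_ {k} X Z)
    × (∀ (Z' : Elem k) → φ lt k Z' Z → _∋_ {k} X Z' → _∋_ {k} Y Z') )

{-# OPTIONS --safe #-}
module Submission where

-- ⟦τ₁⟧ = S^c has |S|^c elements, and ⟦τ_{k+1}⟧ is the set of characteristic
-- functions on ⟦τ_k⟧, hence has 2^|⟦τ_k⟧| elements.  φ¹ is the lexicographic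
-- order on c-tuples.  φ^{k+1}(X, Y) says that the φ^k-least element on which X
-- and Y disagree belongs to Y: the lexicographic order on characteristic
-- functions.  Because ⟦τ_k⟧ is finite and totally ordered by φ^k, two distinct
-- subsets always have such a least point of disagreement, so φ^{k+1} is total.

open import Defs
open import Data.Nat using (ℕ; _≤_; _^_)
open import Data.Fin using (Fin)
open import Relation.Binary.Bundles using (Setoid)
open import Relation.Binary.Structures using (IsStrictTotalOrder)
open import Relation.Binary.PropositionalEquality using (_≡_)
import Relation.Binary.PropositionalEquality as ≡
open import Function.Bundles using (Inverse)
open import Data.Product using (_×_)

open import Level using (Level; _⊔_)
open import Data.Nat using (zero; suc; s≤s; z≤n)
open import Data.Fin using (zero; suc; combine; funToFin; finToFun)
import Data.Fin as Fin
open import Data.Fin.Properties using (funToFin-finToFin; finToFun-funToFin; 2↔Bool)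
open import Data.Vec using (Vec; _∷_; lookup; tabulate)
open import Data.Vec.Properties using (lookup∘tabulate; tabulate∘lookup; tabulate-cong)
open import Data.Vec.Relation.Binary.Pointwise.Inductive using (Pointwise-≡⇒≡; ≡⇒Pointwise-≡)
import Data.Vec.Relation.Binary.Lex.Strict as Lex
open import Data.Bool using (Bool; true)
open import Data.Bool.Properties using (¬-not) renaming (_≟_ to _≟ᵇ_)
open import Data.Product using (Σ-syntax; _,_)
open import Data.Sum using (_⊎_; inj₁; inj₂)
import Data.Sum as Sum
open import Data.Empty using (⊥-elim)
open import Function.Base using (_∘_)
open import Function.Bundles using (Func; _⟨$⟩_)
open import Function.Definitions using (Congruent; StrictlyInverseˡ; StrictlyInverseʳ)
open import Function.Consequences.Setoid using (strictlyInverseˡ⇒inverseˡ; strictlyInverseʳ⇒inverseʳ)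
open import Function.Properties.Inverse using (↔-sym) renaming (trans to ↔-trans)
open import Function.Relation.Binary.Setoid.Equality using (_⇨_)
open import Relation.Binary.Core using (Rel; _⇔_)
open import Relation.Binary.Definitions using (Trichotomous; tri<; tri≈; tri>; _Respects_)
open import Relation.Binary.Structures using (IsStrictPartialOrder)
import Relation.Binary.Construct.Subst.Equality as SubstEq
open import Relation.Binary.PropositionalEquality using (refl; cong; cong₂; _≗_; _≢_)
open import Relation.Nullary using (¬_; yes; no; ¬?)
open import Relation.Nullary.Decidable using (decidable-stable)
open import Relation.Unary using (Pred; Decidable)

private
  variable
    a b ℓ ℓ₁ ℓ₂ ℓ₃ ℓ₄ : Level

mkInverseₛ : {S : Setoid a ℓ₁} {T : Setoid b ℓ₂}
  (to : Setoid.Carrier S → Setoid.Carrier T) (from : Setoid.Carrier T → Setoid.Carrier S)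
  → Congruent (Setoid._≈_ S) (Setoid._≈_ T) to → Congruent (Setoid._≈_ T) (Setoid._≈_ S) from
  → StrictlyInverseˡ (Setoid._≈_ T) to from → StrictlyInverseʳ (Setoid._≈_ S) to from
  → Inverse S T
mkInverseₛ {S = S} {T} to from to-cong from-cong invˡ invʳ = record
  { to        = to
  ; from      = from
  ; to-cong   = to-cong
  ; from-cong = from-cong
  ; inverse   = strictlyInverseˡ⇒inverseˡ S T to-cong invˡ
              , strictlyInverseʳ⇒inverseʳ S T from-cong invʳ
  }

funToFin-cong : ∀ {m n} {f g : Fin m → Fin n} → f ≗ g → funToFin f ≡ funToFin g
funToFin-cong {zero}  f≗g = refl
funToFin-cong {suc m} f≗g = cong₂ combine (f≗g zero) (funToFin-cong (f≗g ∘ suc))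

^-inverse : ∀ m n → Inverse (≡.setoid (Fin n) ⇨ ≡.setoid (Fin m)) (≡.setoid (Fin (m ^ n)))
^-inverse m n = mkInverseₛ
  (λ f → funToFin (f ⟨$⟩_)) (λ i → record { to = finToFun i ; cong = cong (finToFun i) })
  funToFin-cong (λ i≡j x → cong (λ i → finToFun i x) i≡j)
  (funToFin-finToFin {n}) (λ f → finToFun-funToFin (f ⟨$⟩_))

Vec-inverse : ∀ {A : Set a} n → Inverse (≡.setoid (Vec A n)) (≡.setoid (Fin n) ⇨ ≡.setoid A)
Vec-inverse n = mkInverseₛ
  (λ xs → record { to = lookup xs ; cong = cong (lookup xs) }) (λ f → tabulate (f ⟨$⟩_))
  (λ { refl _ → refl }) tabulate-cong
  (λ f → lookup∘tabulate (f ⟨$⟩_)) tabulate∘lookup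

⇨-inverse : {A A′ : Setoid a ℓ₁} {B B′ : Setoid b ℓ₂}
  → Inverse A A′ → Inverse B B′ → Inverse (A ⇨ B) (A′ ⇨ B′)
⇨-inverse {B = B} {B′} I J = mkInverseₛ
  (λ F → record { to = J.to ∘ (F ⟨$⟩_) ∘ I.from ; cong = J.to-cong ∘ Func.cong F ∘ I.from-cong })
  (λ G → record { to = J.from ∘ (G ⟨$⟩_) ∘ I.to ; cong = J.from-cong ∘ Func.cong G ∘ I.to-cong })
  (λ F≈F′ x → J.to-cong (F≈F′ (I.from x)))
  (λ G≈G′ x → J.from-cong (G≈G′ (I.to x)))
  (λ G x → Setoid.trans B′ (J.strictlyInverseˡ _) (Func.cong G (I.strictlyInverseˡ x)))
  (λ F x → Setoid.trans B (J.strictlyInverseʳ _) (Func.cong F (I.strictlyInverseʳ x)))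
  where
  module I = Inverse I
  module J = Inverse J

Dom-inverse : ∀ {Act Prp : Set} (T : LTS Act Prp) c k
  → Inverse (Dom T c k) (≡.setoid (Fin (twr (LTS.size T ^ c) k)))
Dom-inverse T c zero    = ↔-trans (Vec-inverse c) (^-inverse (LTS.size T) c)
Dom-inverse T c (suc k) = ↔-trans (⇨-inverse (Dom-inverse T c k) (↔-sym 2↔Bool)) (^-inverse 2 _)

module _ {A : Set a} {≈₁ : Rel A ℓ₁} {≈₂ : Rel A ℓ₂} {<₁ : Rel A ℓ₃} {<₂ : Rel A ℓ₄} where

  isStrictTotalOrder-⇔ : ≈₁ ⇔ ≈₂ → <₁ ⇔ <₂ → IsStrictTotalOrder ≈₁ <₁ → IsStrictTotalOrder ≈₂ <₂
  isStrictTotalOrder-⇔ ≈⇔@(to≈ , from≈) (to< , from<) sto = record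
    { isStrictPartialOrder = record
      { isEquivalence = SubstEq.isEquivalence ≈⇔ O.isEquivalence
      ; irrefl   = λ x≈y x<y → O.irrefl (from≈ x≈y) (from< x<y)
      ; trans    = λ x<y y<z → to< (O.trans (from< x<y) (from< y<z))
      ; <-resp-≈ = (λ y≈z x<y → to< (O.<-respʳ-≈ (from≈ y≈z) (from< x<y)))
                 , (λ x≈z x<y → to< (O.<-respˡ-≈ (from≈ x≈z) (from< x<y)))
      }
    ; compare = compare
    }
    where
    module O = IsStrictTotalOrder sto
    compare : Trichotomous ≈₂ <₂
    compare x y with O.compare x y
    ... | tri< x<y x≉y x≯y = tri< (to< x<y) (x≉y ∘ from≈) (x≯y ∘ from<)
    ... | tri≈ x≮y x≈y x≯y = tri≈ (x≮y ∘ from<) (to≈ x≈y) (x≯y ∘ from<)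
    ... | tri> x≮y x≉y x>y = tri> (x≮y ∘ from<) (x≉y ∘ from≈) (to< x>y)

module _ {A : Set a} {_≈_ : Rel A ℓ₁} {_<_ : Rel A ℓ₂} (spo : IsStrictPartialOrder _≈_ _<_) where
  open IsStrictPartialOrder spo

  ⊎-compare⇒trichotomous : (∀ x y → x < y ⊎ x ≈ y ⊎ y < x) → Trichotomous _≈_ _<_
  ⊎-compare⇒trichotomous cmp x y with cmp x y
  ... | inj₁ x<y        = tri< x<y (λ x≈y → irrefl x≈y x<y) (λ y<x → irrefl Eq.refl (trans x<y y<x))
  ... | inj₂ (inj₁ x≈y) = tri≈ (irrefl x≈y) x≈y (irrefl (Eq.sym x≈y))
  ... | inj₂ (inj₂ y<x) =
    tri> (λ x<y → irrefl Eq.refl (trans x<y y<x)) (λ x≈y → irrefl (Eq.sym x≈y) y<x) y<x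

Lexᵢ : {A : Set a} → Rel A ℓ → ∀ {n} → Rel (Vec A n) ℓ
Lexᵢ _<_ {n} xs ys = Σ[ i ∈ Fin n ]
  (lookup xs i < lookup ys i × (∀ j → j Fin.< i → ¬ lookup ys j < lookup xs j))

module _ {A : Set a} {_<_ : Rel A ℓ} (<-sto : IsStrictTotalOrder _≡_ _<_) where
  open IsStrictTotalOrder <-sto

  Lex-<⇒Lexᵢ : ∀ {n} {xs ys : Vec A n} → Lex.Lex-< _≡_ _<_ xs ys → Lexᵢ _<_ xs ys
  Lex-<⇒Lexᵢ (Lex.this x<y refl) = zero , x<y , λ _ ()
  Lex-<⇒Lexᵢ (Lex.next refl xs<ys) with Lex-<⇒Lexᵢ xs<ys
  ... | i , xᵢ<yᵢ , before =
    suc i , xᵢ<yᵢ , λ { zero _ → irrefl refl ; (suc j) (s≤s j<i) → before j j<i }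

  Lexᵢ⇒Lex-< : ∀ {n} {xs ys : Vec A n} → Lexᵢ _<_ xs ys → Lex.Lex-< _≡_ _<_ xs ys
  Lexᵢ⇒Lex-< {xs = x ∷ xs} {y ∷ ys} (zero , x<y , _) = Lex.this x<y refl
  Lexᵢ⇒Lex-< {xs = x ∷ xs} {y ∷ ys} (suc i , xᵢ<yᵢ , before) with compare x y
  ... | tri< x<y _ _   = Lex.this x<y refl
  ... | tri≈ _ x≡y _   = Lex.next x≡y (Lexᵢ⇒Lex-< (i , xᵢ<yᵢ , λ j j<i → before (suc j) (s≤s j<i)))
  ... | tri> _ _ y<x   = ⊥-elim (before zero (s≤s z≤n) y<x)

  Lexᵢ-isStrictTotalOrder : ∀ n → IsStrictTotalOrder {A = Vec A n} _≡_ (Lexᵢ _<_)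
  Lexᵢ-isStrictTotalOrder n = isStrictTotalOrder-⇔
    (Pointwise-≡⇒≡ , ≡⇒Pointwise-≡) (Lex-<⇒Lexᵢ , Lexᵢ⇒Lex-<) (Lex.<-isStrictTotalOrder <-sto)

SubsetLex : {D : Setoid a ℓ₁} → Rel (Setoid.Carrier D) ℓ₂ → Rel (Func D (≡.setoid Bool)) (a ⊔ ℓ₂)
SubsetLex {D = D} _<_ X Y = Σ[ z ∈ Setoid.Carrier D ]
  (Y ⟨$⟩ z ≡ true × ¬ X ⟨$⟩ z ≡ true × (∀ z′ → z′ < z → X ⟨$⟩ z′ ≡ true → Y ⟨$⟩ z′ ≡ true))

module _ {D : Setoid a ℓ₁} {_<_ : Rel (Setoid.Carrier D) ℓ₂}
         (<-sto : IsStrictTotalOrder (Setoid._≈_ D) _<_) where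
  open Setoid D using (_≈_) renaming (Carrier to A)
  open IsStrictTotalOrder <-sto

  module _ {P : Pred A ℓ₃} (P? : Decidable P) where

    least-among : ∀ {n} (g : Fin n → A)
      → (∀ i → ¬ P (g i)) ⊎ Σ[ m ∈ A ] (P m × ∀ i → g i < m → ¬ P (g i))
    least-among {zero} g = inj₁ λ ()
    least-among {suc n} g with P? (g zero) | least-among (g ∘ suc)
    ... | no ¬p | inj₁ none = inj₁ λ { zero → ¬p ; (suc i) → none i }
    ... | yes p | inj₁ none = inj₂ (g zero , p , λ
      { zero g₀<g₀ → ⊥-elim (irrefl Eq.refl g₀<g₀) ; (suc i) _ → none i })
    ... | no ¬p | inj₂ (m , pm , below) = inj₂ (m , pm , λ { zero _ → ¬p ; (suc i) → below i })
    ... | yes p | inj₂ (m , pm , below) with g zero <? m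
    ...   | yes g₀<m = inj₂ (g zero , p , λ
      { zero g₀<g₀ → ⊥-elim (irrefl Eq.refl g₀<g₀) ; (suc i) gᵢ<g₀ → below i (trans gᵢ<g₀ g₀<m) })
    ...   | no g₀≮m = inj₂ (m , pm , λ { zero g₀<m → ⊥-elim (g₀≮m g₀<m) ; (suc i) → below i })

    least-or-none : ∀ {N} → Inverse D (≡.setoid (Fin N)) → P Respects _≈_
      → (∀ z → ¬ P z) ⊎ Σ[ m ∈ A ] (P m × ∀ z → z < m → ¬ P z)
    least-or-none enum P-resp = Sum.map
      (λ none z → none (to z) ∘ P-from-to)
      (λ (m , pm , below) → m , pm , λ z z<m →
        below (to z) (<-respˡ-≈ (Eq.sym (strictlyInverseʳ z)) z<m) ∘ P-from-to)
      (least-among from)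
      where
      open Inverse enum
      P-from-to : ∀ {z} → P z → P (from (to z))
      P-from-to {z} = P-resp (Eq.sym (strictlyInverseʳ z))

  open Setoid (D ⇨ ≡.setoid Bool) using () renaming (Carrier to Subset; _≈_ to _≐_)

  private
    _⊏_ : Rel Subset (a ⊔ ℓ₂)
    _⊏_ = SubsetLex {D = D} _<_

  ⊏-irrefl : ∀ {X Y} → X ≐ Y → ¬ X ⊏ Y
  ⊏-irrefl X≐Y (z , Yz , ¬Xz , _) = ¬Xz (≡.trans (X≐Y z) Yz)

  ⊏-trans : ∀ {X Y W} → X ⊏ Y → Y ⊏ W → X ⊏ W
  ⊏-trans {X} {Y} {W} (z₁ , Yz₁ , ¬Xz₁ , X⊆Y) (z₂ , Wz₂ , ¬Yz₂ , Y⊆W) with compare z₁ z₂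
  ... | tri< z₁<z₂ _ _ =
    z₁ , Y⊆W z₁ z₁<z₂ Yz₁ , ¬Xz₁ , λ z z<z₁ → Y⊆W z (trans z<z₁ z₁<z₂) ∘ X⊆Y z z<z₁
  ... | tri≈ _ z₁≈z₂ _ =
    z₁ , ≡.trans (Func.cong W z₁≈z₂) Wz₂ , ¬Xz₁ , λ z z<z₁ → Y⊆W z (<-respʳ-≈ z₁≈z₂ z<z₁) ∘ X⊆Y z z<z₁
  ... | tri> _ _ z₂<z₁ =
    z₂ , Wz₂ , ¬Yz₂ ∘ X⊆Y z₂ z₂<z₁ , λ z z<z₂ → Y⊆W z z<z₂ ∘ X⊆Y z (trans z<z₂ z₂<z₁)

  ⊏-respʳ-≐ : ∀ {X Y Y′} → Y ≐ Y′ → X ⊏ Y → X ⊏ Y′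
  ⊏-respʳ-≐ Y≐Y′ (z , Yz , ¬Xz , X⊆Y) =
    z , ≡.trans (≡.sym (Y≐Y′ z)) Yz , ¬Xz , λ z′ z′<z → ≡.trans (≡.sym (Y≐Y′ z′)) ∘ X⊆Y z′ z′<z

  ⊏-respˡ-≐ : ∀ {Y X X′} → X ≐ X′ → X ⊏ Y → X′ ⊏ Y
  ⊏-respˡ-≐ X≐X′ (z , Yz , ¬Xz , X⊆Y) =
    z , Yz , ¬Xz ∘ ≡.trans (X≐X′ z) , λ z′ z′<z → X⊆Y z′ z′<z ∘ ≡.trans (X≐X′ z′)

  ⊏-isStrictPartialOrder : IsStrictPartialOrder _≐_ _⊏_
  ⊏-isStrictPartialOrder = record
    { isEquivalence = Setoid.isEquivalence (D ⇨ ≡.setoid Bool)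
    ; irrefl        = λ {X} {Y} → ⊏-irrefl {X} {Y}
    ; trans         = λ {X} {Y} {W} → ⊏-trans {X} {Y} {W}
    ; <-resp-≈      = (λ {X} {Y} {Y′} → ⊏-respʳ-≐ {X} {Y} {Y′})
                    , (λ {Y} {X} {X′} → ⊏-respˡ-≐ {Y} {X} {X′})
    }

  ⊏-at-first-difference : ∀ {X Y} m → X ⟨$⟩ m ≢ Y ⟨$⟩ m → (∀ z → z < m → X ⟨$⟩ z ≡ Y ⟨$⟩ z)
    → X ⊏ Y ⊎ Y ⊏ X
  ⊏-at-first-difference {X} {Y} m Xm≢Ym agree with X ⟨$⟩ m ≟ᵇ true | Y ⟨$⟩ m ≟ᵇ true
  ... | no ¬Xm | yes Ym  = inj₁ (m , Ym , ¬Xm , λ z z<m → ≡.trans (≡.sym (agree z z<m)))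
  ... | yes Xm | no ¬Ym  = inj₂ (m , Xm , ¬Ym , λ z z<m → ≡.trans (agree z z<m))
  ... | yes Xm | yes Ym  = ⊥-elim (Xm≢Ym (≡.trans Xm (≡.sym Ym)))
  ... | no ¬Xm | no ¬Ym = ⊥-elim (Xm≢Ym (≡.trans (¬-not ¬Xm) (≡.sym (¬-not ¬Ym))))

  ⊏-compare : ∀ {N} → Inverse D (≡.setoid (Fin N)) → ∀ X Y → X ⊏ Y ⊎ X ≐ Y ⊎ Y ⊏ X
  ⊏-compare enum X Y = Sum.[ inj₂ ∘ inj₁ ∘ agree-everywhere , Sum.map₂ inj₂ ∘ first-difference ]
    (least-or-none differ? enum differ-resp)
    where
    differ? : Decidable (λ z → X ⟨$⟩ z ≢ Y ⟨$⟩ z)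
    differ? z = ¬? (X ⟨$⟩ z ≟ᵇ Y ⟨$⟩ z)
    differ-resp : (λ z → X ⟨$⟩ z ≢ Y ⟨$⟩ z) Respects _≈_
    differ-resp z≈z′ Xz≢Yz Xz′≡Yz′ =
      Xz≢Yz (≡.trans (Func.cong X z≈z′) (≡.trans Xz′≡Yz′ (≡.sym (Func.cong Y z≈z′))))
    agree-everywhere : (∀ z → ¬ X ⟨$⟩ z ≢ Y ⟨$⟩ z) → X ≐ Y
    agree-everywhere none z = decidable-stable (X ⟨$⟩ z ≟ᵇ Y ⟨$⟩ z) (none z)
    first-difference : Σ[ m ∈ A ] (X ⟨$⟩ m ≢ Y ⟨$⟩ m × ∀ z → z < m → ¬ X ⟨$⟩ z ≢ Y ⟨$⟩ z)
      → X ⊏ Y ⊎ Y ⊏ X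
    first-difference (m , Xm≢Ym , below) =
      ⊏-at-first-difference {X} {Y} m Xm≢Ym λ z z<m →
        decidable-stable (X ⟨$⟩ z ≟ᵇ Y ⟨$⟩ z) (below z z<m)

  ⊏-isStrictTotalOrder : ∀ {N} → Inverse D (≡.setoid (Fin N)) → IsStrictTotalOrder _≐_ _⊏_
  ⊏-isStrictTotalOrder enum = record
    { isStrictPartialOrder = ⊏-isStrictPartialOrder
    ; compare = ⊎-compare⇒trichotomous ⊏-isStrictPartialOrder (⊏-compare enum)
    }

lemma2 : {Act Prp : Set} (lt : Act) (c : ℕ) → 2 ≤ c → (T : LTS Act Prp)
    → IsStrictTotalOrder {A = Fin (LTS.size T)} _≡_ (λ s t → LTS.trans T s lt t)
    → (k : ℕ)
    → Inverse (Dom T c k) (≡.setoid (Fin (twr (LTS.size T ^ c) k)))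
    × IsStrictTotalOrder (Setoid._≈_ (Dom T c k)) (φ T c lt k)
lemma2 lt c _ T <-sto k = Dom-inverse T c k , φ-isStrictTotalOrder k
  where
  φ-isStrictTotalOrder : ∀ k → IsStrictTotalOrder (Setoid._≈_ (Dom T c k)) (φ T c lt k)
  φ-isStrictTotalOrder zero    = Lexᵢ-isStrictTotalOrder <-sto c
  φ-isStrictTotalOrder (suc k) = ⊏-isStrictTotalOrder (φ-isStrictTotalOrder k) (Dom-inverse T c k)
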